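{- The strategy $\mathcal S^\dagger_{\min}$ is optimal for the game $(\mathcal D''_k,n)$, i.e. for every strategy $\mathcal S'$ for this game and every $t$, $\Pr(H(\mathcal S^\dagger_{\min})\le t)\ge\Pr(H(\mathcal S')\le t)$.
   Context: Semi-random multigraph process (online version): start with the empty multigraph on $[n]$; in each round a vertex $v$ is chosen uniformly at random from $[n]$, independently of previous rounds, and Builder chooses a vertex $u$ (depending only on the history, $v$ and his own randomness; $u=v$ allowed) and adds the edge $uv$. Game $(\mathcal D''_k,n)$ ($k$ a positive integer): reach a multigraph in which every vertex has degree at least $k$, degrees counting edges with multiplicity and each loop contributing $2$. $H(\mathcal S)$ denotes the number of rounds strategy $\mathcal S$ needs to win. Strategy $\mathcal S^\dagger_{\min}$: when a vertex $v$ is offered, first increase its degree by one, and then choose $u$ uniformly at random among all vertices of minimum degree at that point (with $v$'s degree thus increased), and add the edge $uv$.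
   Formalization: The strategies $\mathcal S'$ choose $u$ from a distribution that depends on the history and the offered vertex $v$ and whose probabilities are rational. -}

module Defs where

open import Data.Nat using (ℕ; zero; suc; _⊓_)
open import Data.Nat as ℕ using ()
open import Data.Fin using (Fin; _≟_)
open import Data.List using (List; []; _∷_; foldr; map; allFin)
open import Data.Bool using (_∧_)
open import Relation.Binary.PropositionalEquality using (_≡_)
open import Data.Product using (_×_; _,_)
open import Data.Bool using (Bool; true; false; if_then_else_)
open import Relation.Nullary using (does)
open import Data.Integer using (+_)
open import Data.Rational using (ℚ; 0ℚ; 1ℚ; _+_; _*_; _/_; _≤_)

-- A history: the list of rounds played so far, most recent first.
-- Each round is a pair (v , u): v the randomly offered vertex,
-- u the vertex chosen by Builder; the edge uv is added (u = v gives a loop).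
History : ℕ → Set
History n = List (Fin n × Fin n)

[_≡ᵇ_] : ∀ {n} → Fin n → Fin n → ℕ
[ a ≡ᵇ b ] = if does (a ≟ b) then 1 else 0

-- degree of w in the multigraph built by history h
-- (edges with multiplicity; a loop at w contributes 2)
deg : ∀ {n} → History n → Fin n → ℕ
deg [] w = 0
deg ((v , u) ∷ h) w = [ v ≡ᵇ w ] ℕ.+ [ u ≡ᵇ w ] ℕ.+ deg h w

won : ∀ {n} → ℕ → History n → Bool
won {n} k h = foldr (λ w b → does (k ℕ.≤? deg h w) ∧ b) true (allFin n)

ΣQ : ∀ n → (Fin n → ℚ) → ℚ
ΣQ n f = foldr (λ w acc → f w + acc) 0ℚ (allFin n)

-- A (behavioural, possibly randomised) strategy of Builder: given the
-- history and the offered vertex v, a probability distribution on the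
-- choice of u.
Strategy : ℕ → Set
Strategy n = History n → Fin n → Fin n → ℚ

IsStrategy : ∀ {n} → Strategy n → Set
IsStrategy {n} σ = ∀ h v → (∀ u → 0ℚ ≤ σ h v u) × ΣQ n (σ h v) ≡ 1ℚ

inv : ℕ → ℚ
inv zero = 0ℚ
inv (suc m) = (+ 1) / suc m

-- Pr(H(σ) ≤ t) when starting from history h (for the game D''_k on [n]):
-- the game stops as soon as it is won; otherwise a vertex v is offered
-- uniformly at random and Builder picks u with probability σ h v u.
winProbFrom : ∀ {n} → ℕ → Strategy n → History n → ℕ → ℚ
winProbFrom k σ h zero = if won k h then 1ℚ else 0ℚ
winProbFrom {n} k σ h (suc t) =
  if won k h then 1ℚ
  else ΣQ n (λ v → inv n * ΣQ n (λ u → σ h v u * winProbFrom k σ ((v , u) ∷ h) t))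

winProb : ∀ {n} → ℕ → Strategy n → ℕ → ℚ
winProb k σ t = winProbFrom k σ [] t

-- The strategy S†_min: when v is offered, increase deg(v) by one, then
-- choose u uniformly among vertices of minimum degree (with v's degree
-- increased), and add uv.
degPlus : ∀ {n} → History n → Fin n → Fin n → ℕ
degPlus h v w = deg h w ℕ.+ [ v ≡ᵇ w ]

minDeg : ∀ {n} → History n → Fin n → ℕ
minDeg {n} h v = foldr (λ w m → degPlus h v w ⊓ m) (degPlus h v v) (allFin n)

isMin : ∀ {n} → History n → Fin n → Fin n → ℕ
isMin h v u = if does (degPlus h v u ℕ.≟ minDeg h v) then 1 else 0

countMin : ∀ {n} → History n → Fin n → ℕ
countMin {n} h v = foldr (λ w c → isMin h v w ℕ.+ c) 0 (allFin n)

S†min : ∀ {n} → Strategy n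
S†min h v u = ((+ isMin h v u) / 1) * inv (countMin h v)

module Submission where

-- Let value h t be the probability that S†min, started from history h, wins
-- within t more rounds.  Only degrees capped at k matter for winning.  Call a
-- degree vector X at least as good as Y on a pair of vertices {p , q} when X
-- and Y agree off {p , q} and, on {p , q}, the capped degrees of X have at
-- least as large a minimum and at least as large a sum as those of Y.  The
-- core of the proof is that value is monotone along this relation, shown by
-- induction on t.  The induction step combines three one-round facts:
--   (i)  answering an offered vertex with a vertex of minimum degree is best,
--        so the S†min-average of the continuation values is the best answer;
--   (ii) the relation survives a round in which both sides answer suitably;
--   (iii) the uniform offer is handled by pairing the offers p and q.
-- Optimality is then a second induction on t: any strategy averages
-- continuation values, each bounded by the best answer, which S†min attains.

open import Defs
open import Data.Nat using (ℕ)
open import Data.Rational using (_≤_)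

import Data.Nat as Nat
import Data.Nat.Properties as Natₚ
open import Data.Nat.Coprimality using (1-coprimeTo) renaming (sym to coprime-sym)
open import Data.Integer using (+_)
import Data.Integer.Properties as ℤₚ
open import Data.Rational using (ℚ; 0ℚ; 1ℚ; _+_; _*_; _/_; mkℚ; nonNegative)
open import Data.Rational.Properties
  using (≤-refl; ≤-trans; ≤-reflexive; +-mono-≤; *-monoˡ-≤-nonNeg; +-identityˡ; +-assoc;
         +-comm; *-distribʳ-+; *-distribˡ-+; *-identityˡ; *-identityʳ; *-zeroˡ; *-inverseʳ;
         normalize-coprime; normalize-nonNeg; nonNegative⁻¹; nonNeg*nonNeg⇒nonNeg)
open import Data.Fin using (Fin; zero; suc; _≟_)
open import Data.List using (List; []; _∷_; foldr; allFin; tabulate; length)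
open import Data.List.Properties using (length-tabulate)
open import Data.List.Membership.Propositional using (_∈_)
open import Data.List.Membership.Propositional.Properties using (∈-allFin)
open import Data.List.Relation.Unary.Any using (here; there)
open import Data.Product using (_×_; _,_; proj₁; proj₂; ∃)
open import Data.Sum using (_⊎_; inj₁; inj₂)
import Data.Sum as Sum
open import Data.Bool using (Bool; true; false; if_then_else_; _∧_; T)
open import Data.Unit using (tt)
open import Data.Empty using (⊥-elim)
open import Relation.Nullary using (yes; no; does; Dec)
open import Relation.Binary.PropositionalEquality
open import Function using (_∘_; id)

open Nat using (_⊓_; s≤s) renaming (_≤_ to _≤ₙ_; _<_ to _<ₙ_)

ofℕ : ℕ → ℚ
ofℕ a = (+ a) / 1

ofℕ-normal : ∀ a → ofℕ a ≡ mkℚ (+ a) 0 (coprime-sym (1-coprimeTo a))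
ofℕ-normal a = normalize-coprime (coprime-sym (1-coprimeTo a))

ofℕ-+ : ∀ a b → ofℕ a + ofℕ b ≡ ofℕ (a Nat.+ b)
ofℕ-+ a b rewrite ofℕ-normal a | ofℕ-normal b | Natₚ.*-identityʳ a | Natₚ.*-identityʳ b
  | ℤₚ.+◃n≡+n a | ℤₚ.+◃n≡+n b = refl

ofℕ*inv : ∀ m → ofℕ (Nat.suc m) * inv (Nat.suc m) ≡ 1ℚ
ofℕ*inv m rewrite ofℕ-normal (Nat.suc m) | normalize-coprime (1-coprimeTo (Nat.suc m)) =
  *-inverseʳ (mkℚ (+ Nat.suc m) 0 (coprime-sym (1-coprimeTo (Nat.suc m))))

-- the uniform weights 1/n on n vertices have total mass at most 1 (0 if n = 0)
ofℕ*inv≤1 : ∀ m → ofℕ m * inv m ≤ 1ℚ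
ofℕ*inv≤1 Nat.zero = nonNegative⁻¹ 1ℚ
ofℕ*inv≤1 (Nat.suc m) = ≤-reflexive (ofℕ*inv m)

ofℕ-nonNeg : ∀ a → 0ℚ ≤ ofℕ a
ofℕ-nonNeg a = nonNegative⁻¹ _ {{normalize-nonNeg a 1}}

inv-nonNeg : ∀ a → 0ℚ ≤ inv a
inv-nonNeg Nat.zero = ≤-refl
inv-nonNeg (Nat.suc m) = nonNegative⁻¹ _ {{normalize-nonNeg 1 (Nat.suc m)}}

*-nonNeg : ∀ {p q} → 0ℚ ≤ p → 0ℚ ≤ q → 0ℚ ≤ p * q
*-nonNeg {p} {q} 0≤p 0≤q =
  nonNegative⁻¹ _ {{nonNeg*nonNeg⇒nonNeg p {{nonNegative 0≤p}} q {{nonNegative 0≤q}}}}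

*-monoˡ-nonNeg : ∀ {r p q} → 0ℚ ≤ r → p ≤ q → r * p ≤ r * q
*-monoˡ-nonNeg {r} 0≤r = *-monoˡ-≤-nonNeg r {{nonNegative 0≤r}}

+-exchange : ∀ a b c → a + (b + c) ≡ b + (a + c)
+-exchange a b c = trans (sym (+-assoc a b c)) (trans (cong (_+ c) (+-comm a b)) (+-assoc b a c))

module _ {A : Set} where
  sumL : List A → (A → ℚ) → ℚ
  sumL L f = foldr (λ w acc → f w + acc) 0ℚ L

  sumℕ : List A → (A → ℕ) → ℕ
  sumℕ L g = foldr (λ w c → g w Nat.+ c) 0 L

  sumL-mono : ∀ L {f g : A → ℚ} → (∀ w → f w ≤ g w) → sumL L f ≤ sumL L g
  sumL-mono [] f≤g = ≤-refl
  sumL-mono (x ∷ L) f≤g = +-mono-≤ (f≤g x) (sumL-mono L f≤g)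

  sumL-cong : ∀ L {f g : A → ℚ} → (∀ w → f w ≡ g w) → sumL L f ≡ sumL L g
  sumL-cong [] f≡g = refl
  sumL-cong (x ∷ L) f≡g = cong₂ _+_ (f≡g x) (sumL-cong L f≡g)

  sumL-*ʳ : ∀ L (f : A → ℚ) c → sumL L (λ w → f w * c) ≡ sumL L f * c
  sumL-*ʳ [] f c = sym (*-zeroˡ c)
  sumL-*ʳ (x ∷ L) f c =
    trans (cong (λ z → f x * c + z) (sumL-*ʳ L f c)) (sym (*-distribʳ-+ c (f x) (sumL L f)))

  sumL-ofℕ : ∀ L (g : A → ℕ) → sumL L (ofℕ ∘ g) ≡ ofℕ (sumℕ L g)
  sumL-ofℕ [] g = refl
  sumL-ofℕ (x ∷ L) g = trans (cong (λ z → ofℕ (g x) + z) (sumL-ofℕ L g)) (ofℕ-+ (g x) (sumℕ L g))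

  sumL-const : ∀ L c → sumL L (λ _ → c) ≡ ofℕ (length L) * c
  sumL-const L c = begin
    sumL L (λ _ → c)                 ≡⟨ sumL-cong L (λ _ → sym (*-identityˡ c)) ⟩
    sumL L (λ _ → ofℕ 1 * c)         ≡⟨ sumL-*ʳ L (λ _ → ofℕ 1) c ⟩
    sumL L (λ _ → ofℕ 1) * c         ≡⟨ cong (_* c) (sumL-ofℕ L (λ _ → 1)) ⟩
    ofℕ (sumℕ L (λ _ → 1)) * c       ≡⟨ cong (λ m → ofℕ m * c) (count L) ⟩
    ofℕ (length L) * c               ∎
    where
    open ≡-Reasoning
    count : ∀ L → sumℕ L (λ _ → 1) ≡ length L
    count [] = refl
    count (x ∷ L) = cong Nat.suc (count L)

  sumℕ-≥ : ∀ (g : A → ℕ) L {w} → w ∈ L → g w ≤ₙ sumℕ L g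
  sumℕ-≥ g (y ∷ L) (here refl) = Natₚ.m≤m+n (g y) _
  sumℕ-≥ g (y ∷ L) (there w∈L) = Natₚ.≤-trans (sumℕ-≥ g L w∈L) (Natₚ.m≤n+m _ (g y))

  IsDistribution : List A → (A → ℚ) → Set
  IsDistribution L s = (∀ u → 0ℚ ≤ s u) × sumL L s ≡ 1ℚ

  -- Averaging with nonnegative weights is monotone; values off the support are irrelevant.
  weighted-mono : ∀ L (s : A → ℚ) {x y : A → ℚ} → (∀ u → 0ℚ ≤ s u) →
                  (∀ u → s u ≡ 0ℚ ⊎ x u ≤ y u) →
                  sumL L (λ u → s u * x u) ≤ sumL L (λ u → s u * y u)
  weighted-mono L s {x} {y} 0≤s x≤y = sumL-mono L pointwise
    where
    pointwise : ∀ u → s u * x u ≤ s u * y u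
    pointwise u with x≤y u
    ... | inj₁ s≡0 rewrite s≡0 = ≤-reflexive (trans (*-zeroˡ (x u)) (sym (*-zeroˡ (y u))))
    ... | inj₂ le = *-monoˡ-nonNeg (0≤s u) le

  average-const : ∀ L (s : A → ℚ) c → sumL L s ≡ 1ℚ → sumL L (λ u → s u * c) ≡ c
  average-const L s c Σs≡1 = trans (sumL-*ʳ L s c) (trans (cong (_* c) Σs≡1) (*-identityˡ c))

  average-≤ : ∀ L {s x : A → ℚ} y → IsDistribution L s → (∀ u → s u ≡ 0ℚ ⊎ x u ≤ y) →
              sumL L (λ u → s u * x u) ≤ y
  average-≤ L {s} y (0≤s , Σs≡1) x≤y =
    ≤-trans (weighted-mono L s 0≤s x≤y) (≤-reflexive (average-const L s y Σs≡1))

  average-≥ : ∀ L {s x : A → ℚ} y → IsDistribution L s → (∀ u → s u ≡ 0ℚ ⊎ y ≤ x u) →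
              y ≤ sumL L (λ u → s u * x u)
  average-≥ L {s} y (0≤s , Σs≡1) y≤x =
    ≤-trans (≤-reflexive (sym (average-const L s y Σs≡1))) (weighted-mono L s 0≤s y≤x)

-- Sums over Fin n by recursion on n, used to compare sums that differ in two places.
sumFin : ∀ n → (Fin n → ℚ) → ℚ
sumFin Nat.zero f = 0ℚ
sumFin (Nat.suc n) f = f zero + sumFin n (f ∘ suc)

ΣQ≡sumFin : ∀ n f → ΣQ n f ≡ sumFin n f
ΣQ≡sumFin n f = go n id
  where
  go : ∀ m (e : Fin m → Fin n) → sumL (tabulate e) f ≡ sumFin m (f ∘ e)
  go Nat.zero e = refl
  go (Nat.suc m) e = cong (λ z → f (e zero) + z) (go m (e ∘ suc))

sumFin-mono : ∀ n {f g : Fin n → ℚ} → (∀ w → f w ≤ g w) → sumFin n f ≤ sumFin n g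
sumFin-mono Nat.zero f≤g = ≤-refl
sumFin-mono (Nat.suc n) f≤g = +-mono-≤ (f≤g zero) (sumFin-mono n (f≤g ∘ suc))

erase : ∀ {n} → Fin n → (Fin n → ℚ) → Fin n → ℚ
erase zero f zero = 0ℚ
erase zero f (suc w) = f (suc w)
erase (suc p) f zero = f zero
erase (suc p) f (suc w) = erase p (f ∘ suc) w

erase-same : ∀ {n} (p : Fin n) f → erase p f p ≡ 0ℚ
erase-same zero f = refl
erase-same (suc p) f = erase-same p (f ∘ suc)

erase-other : ∀ {n} (p : Fin n) f {w} → w ≢ p → erase p f w ≡ f w
erase-other zero f {zero} w≢p = ⊥-elim (w≢p refl)
erase-other zero f {suc w} w≢p = refl
erase-other (suc p) f {zero} w≢p = refl
erase-other (suc p) f {suc w} w≢p = erase-other p (f ∘ suc) (w≢p ∘ cong suc)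

sumFin-extract : ∀ n (p : Fin n) f → sumFin n f ≡ f p + sumFin n (erase p f)
sumFin-extract (Nat.suc n) zero f = cong (λ z → f zero + z) (sym (+-identityˡ (sumFin n (f ∘ suc))))
sumFin-extract (Nat.suc n) (suc p) f =
  trans (cong (λ z → f zero + z) (sumFin-extract n p (f ∘ suc))) (+-exchange (f zero) (f (suc p)) _)

sumFin-pair-mono : ∀ n {p q : Fin n} (f g : Fin n → ℚ) → p ≢ q →
                   (∀ w → w ≢ p → w ≢ q → g w ≤ f w) → g p + g q ≤ f p + f q →
                   sumFin n g ≤ sumFin n f
sumFin-pair-mono n {p} {q} f g p≢q outside onPair = begin
  sumFin n g                  ≡⟨ split g ⟩
  (g p + g q) + rest g        ≤⟨ +-mono-≤ onPair (sumFin-mono n rest-≤) ⟩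
  (f p + f q) + rest f        ≡⟨ split f ⟨
  sumFin n f                  ∎
  where
  open Data.Rational.Properties.≤-Reasoning
  rest : (Fin n → ℚ) → ℚ
  rest h = sumFin n (erase q (erase p h))
  split : ∀ h → sumFin n h ≡ (h p + h q) + rest h
  split h =
    trans (sumFin-extract n p h)
     (trans (cong (λ z → h p + z) (sumFin-extract n q (erase p h)))
      (trans (cong (λ z → h p + (z + rest h)) (erase-other p h (p≢q ∘ sym)))
       (sym (+-assoc (h p) (h q) _))))
  rest-≤ : ∀ w → erase q (erase p g) w ≤ erase q (erase p f) w
  rest-≤ w with w ≟ q
  ... | yes refl = ≤-reflexive (trans (erase-same w _) (sym (erase-same w _)))
  ... | no w≢q with w ≟ p
  ... | yes refl = ≤-reflexive (trans (erase-other q _ w≢q) (trans (erase-same w g)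
                     (sym (trans (erase-other q _ w≢q) (erase-same w f)))))
  ... | no w≢p rewrite erase-other q (erase p g) w≢q | erase-other q (erase p f) w≢q
                     | erase-other p g w≢p | erase-other p f w≢p = outside w w≢p w≢q

-- Degree beyond k never helps, so degrees are
-- compared through ⌊ x ⌋ = min(x , k).
module Capped (k : ℕ) where
  ⌊_⌋ : ℕ → ℕ
  ⌊ x ⌋ = x ⊓ k

  AboveMin : ℕ → ℕ → ℕ → Set
  AboveMin x b b' = (⌊ b ⌋ ≤ₙ ⌊ x ⌋) ⊎ (⌊ b' ⌋ ≤ₙ ⌊ x ⌋)

  record Dominates (a a' b b' : ℕ) : Set where
    constructor dom
    field
      first  : AboveMin a b b'
      second : AboveMin a' b b'
      sum    : ⌊ b ⌋ Nat.+ ⌊ b' ⌋ ≤ₙ ⌊ a ⌋ Nat.+ ⌊ a' ⌋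
  open Dominates public

  ⌊⌋-≤k : ∀ x → ⌊ x ⌋ ≤ₙ k
  ⌊⌋-≤k x = Natₚ.m⊓n≤n x k

  ⌊⌋-≤ : ∀ x → ⌊ x ⌋ ≤ₙ x
  ⌊⌋-≤ x = Natₚ.m⊓n≤m x k

  ⌊⌋-mono : ∀ {x y} → x ≤ₙ y → ⌊ x ⌋ ≤ₙ ⌊ y ⌋
  ⌊⌋-mono = Natₚ.⊓-monoˡ-≤ k

  ⌊⌋-saturated : ∀ {x} → k ≤ₙ x → ⌊ x ⌋ ≡ k
  ⌊⌋-saturated = Natₚ.m≥n⇒m⊓n≡n

  ⌊suc⌋-≤ : ∀ x → ⌊ Nat.suc x ⌋ ≤ₙ Nat.suc ⌊ x ⌋
  ⌊suc⌋-≤ x = Natₚ.⊓-monoʳ-≤ (Nat.suc x) (Natₚ.n≤1+n k)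

  ⌊suc⌋-below : ∀ {x} → x <ₙ k → ⌊ Nat.suc x ⌋ ≡ Nat.suc ⌊ x ⌋
  ⌊suc⌋-below x<k = trans (Natₚ.m≤n⇒m⊓n≡m x<k) (cong Nat.suc (sym (Natₚ.m≤n⇒m⊓n≡m (Natₚ.<⇒≤ x<k))))

  ⌊suc⌋-saturated : ∀ {x} → k ≤ₙ x → ⌊ Nat.suc x ⌋ ≡ k
  ⌊suc⌋-saturated k≤x = ⌊⌋-saturated (Natₚ.m≤n⇒m≤1+n k≤x)

  ⌊suc⌋-mono : ∀ {a b} → ⌊ b ⌋ ≤ₙ ⌊ a ⌋ → ⌊ Nat.suc b ⌋ ≤ₙ ⌊ Nat.suc a ⌋
  ⌊suc⌋-mono {a} {b} le with a Nat.<? k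
  ... | yes a<k rewrite ⌊suc⌋-below a<k = Natₚ.≤-trans (⌊suc⌋-≤ b) (s≤s le)
  ... | no a≮k rewrite ⌊suc⌋-saturated (Natₚ.≮⇒≥ a≮k) = ⌊⌋-≤k (Nat.suc b)

  aboveMin-swap : ∀ {x b b'} → AboveMin x b b' → AboveMin x b' b
  aboveMin-swap = Sum.swap

  aboveMin-saturated : ∀ {x b b'} → AboveMin x b b' → k ≤ₙ b → k ≤ₙ b' → k ≤ₙ x
  aboveMin-saturated (inj₁ le) k≤b k≤b' rewrite ⌊⌋-saturated k≤b = Natₚ.≤-trans le (⌊⌋-≤ _)
  aboveMin-saturated (inj₂ le) k≤b k≤b' rewrite ⌊⌋-saturated k≤b' = Natₚ.≤-trans le (⌊⌋-≤ _)

  dominates-cong : ∀ {a₁ a₁' b₁ b₁' a₂ a₂' b₂ b₂'} → a₁ ≡ a₂ → a₁' ≡ a₂' → b₁ ≡ b₂ → b₁' ≡ b₂' →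
                   Dominates a₂ a₂' b₂ b₂' → Dominates a₁ a₁' b₁ b₁'
  dominates-cong refl refl refl refl d = d

  swapˡ : ∀ {a a' b b'} → Dominates a a' b b' → Dominates a' a b b'
  swapˡ {a} {a'} {b} {b'} (dom f s Σ≤) =
    dom s f (subst (⌊ b ⌋ Nat.+ ⌊ b' ⌋ ≤ₙ_) (Natₚ.+-comm ⌊ a ⌋ ⌊ a' ⌋) Σ≤)

  swapʳ : ∀ {a a' b b'} → Dominates a a' b b' → Dominates a a' b' b
  swapʳ {a} {a'} {b} {b'} (dom f s Σ≤) =
    dom (aboveMin-swap f) (aboveMin-swap s) (subst (_≤ₙ ⌊ a ⌋ Nat.+ ⌊ a' ⌋) (Natₚ.+-comm ⌊ b ⌋ ⌊ b' ⌋) Σ≤)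

  dominates-first : ∀ {a a' b b'} → Dominates a a' b b' → b ≤ₙ b' → ⌊ b ⌋ ≤ₙ ⌊ a ⌋
  dominates-first (dom (inj₁ b≤a) _ _) b≤b' = b≤a
  dominates-first (dom (inj₂ b'≤a) _ _) b≤b' = Natₚ.≤-trans (⌊⌋-mono b≤b') b'≤a

  -- Adding the new edge-end to the smaller of two equal-context degrees
  -- beats adding it to the larger one:  (e' + 1 , e) dominates (e' , e + 1).
  dominates-lower-end : ∀ {e' e} → e' ≤ₙ e → Dominates (Nat.suc e') e e' (Nat.suc e)
  dominates-lower-end {e'} {e} e'≤e = dom (inj₁ (⌊⌋-mono (Natₚ.n≤1+n e'))) (inj₁ (⌊⌋-mono e'≤e)) Σ≤
    where
    Σ≤ : ⌊ e' ⌋ Nat.+ ⌊ Nat.suc e ⌋ ≤ₙ ⌊ Nat.suc e' ⌋ Nat.+ ⌊ e ⌋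
    Σ≤ with e' Nat.<? k
    ... | yes e'<k rewrite ⌊suc⌋-below e'<k =
          Natₚ.≤-trans (Natₚ.+-monoʳ-≤ ⌊ e' ⌋ (⌊suc⌋-≤ e)) (Natₚ.≤-reflexive (Natₚ.+-suc ⌊ e' ⌋ ⌊ e ⌋))
    ... | no e'≮k
          rewrite ⌊⌋-saturated (Natₚ.≮⇒≥ e'≮k) | ⌊suc⌋-saturated (Natₚ.≮⇒≥ e'≮k)
                | ⌊⌋-saturated (Natₚ.≤-trans (Natₚ.≮⇒≥ e'≮k) e'≤e)
                | ⌊suc⌋-saturated (Natₚ.≤-trans (Natₚ.≮⇒≥ e'≮k) e'≤e) = Natₚ.≤-refl

  dominates-raise-smaller : ∀ {a a' b b'} → Dominates a a' b b' → a ≤ₙ a' → b ≤ₙ b' →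
                            Dominates (Nat.suc a) a' (Nat.suc b) b'
  dominates-raise-smaller {a} {a'} {b} {b'} d@(dom _ s Σ≤) a≤a' b≤b' =
    dom (inj₁ (⌊suc⌋-mono (dominates-first d b≤b'))) (second' s) Σ≤'
    where
    -- if a' was only as high as ⌊ b ⌋, then a = a' = b after capping, and the sum forces b' ≤ a'
    second' : AboveMin a' b b' → AboveMin a' (Nat.suc b) b'
    second' (inj₂ b'≤a') = inj₂ b'≤a'
    second' (inj₁ b≤a') with Natₚ.m≤n⇒m<n∨m≡n b≤a'
    ... | inj₁ b<a' = inj₁ (Natₚ.≤-trans (⌊suc⌋-≤ b) b<a')
    ... | inj₂ b≡a' = inj₂ (subst (⌊ b' ⌋ ≤ₙ_) b≡a'
            (Natₚ.+-cancelˡ-≤ ⌊ b ⌋ ⌊ b' ⌋ ⌊ b ⌋ (Natₚ.≤-trans Σ≤ (Natₚ.≤-reflexive (cong₂ Nat._+_ a≡b (sym b≡a'))))))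
      where
      a≡b : ⌊ a ⌋ ≡ ⌊ b ⌋
      a≡b = Natₚ.≤-antisym (Natₚ.≤-trans (⌊⌋-mono a≤a') (Natₚ.≤-reflexive (sym b≡a'))) (dominates-first d b≤b')
    Σ≤' : ⌊ Nat.suc b ⌋ Nat.+ ⌊ b' ⌋ ≤ₙ ⌊ Nat.suc a ⌋ Nat.+ ⌊ a' ⌋
    Σ≤' with a Nat.<? k
    ... | yes a<k rewrite ⌊suc⌋-below a<k = Natₚ.≤-trans (Natₚ.+-monoˡ-≤ ⌊ b' ⌋ (⌊suc⌋-≤ b)) (s≤s Σ≤)
    ... | no a≮k rewrite ⌊suc⌋-saturated (Natₚ.≮⇒≥ a≮k) | ⌊⌋-saturated (Natₚ.≤-trans (Natₚ.≮⇒≥ a≮k) a≤a') =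
          Natₚ.+-mono-≤ (⌊⌋-≤k (Nat.suc b)) (⌊⌋-≤k b')

  dominates-raise-larger : ∀ {a a' b b'} → Dominates a a' b b' → a ≤ₙ a' → b ≤ₙ b' →
                           Dominates a (Nat.suc a') b (Nat.suc b')
  dominates-raise-larger {a} {a'} {b} {b'} d@(dom _ _ Σ≤) a≤a' b≤b' =
    dom (inj₁ b≤a) (inj₁ (Natₚ.≤-trans b≤a (⌊⌋-mono (Natₚ.m≤n⇒m≤1+n a≤a')))) Σ≤'
    where
    b≤a : ⌊ b ⌋ ≤ₙ ⌊ a ⌋
    b≤a = dominates-first d b≤b'
    Σ≤' : ⌊ b ⌋ Nat.+ ⌊ Nat.suc b' ⌋ ≤ₙ ⌊ a ⌋ Nat.+ ⌊ Nat.suc a' ⌋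
    Σ≤' with a' Nat.<? k
    ... | yes a'<k rewrite ⌊suc⌋-below a'<k =
          Natₚ.≤-trans (Natₚ.+-monoʳ-≤ ⌊ b ⌋ (⌊suc⌋-≤ b'))
            (Natₚ.≤-trans (Natₚ.≤-reflexive (Natₚ.+-suc ⌊ b ⌋ ⌊ b' ⌋))
              (Natₚ.≤-trans (s≤s Σ≤) (Natₚ.≤-reflexive (sym (Natₚ.+-suc ⌊ a ⌋ ⌊ a' ⌋)))))
    ... | no a'≮k rewrite ⌊suc⌋-saturated (Natₚ.≮⇒≥ a'≮k) = Natₚ.+-mono-≤ b≤a (⌊⌋-≤k _)

≡ᵇ-refl : ∀ {n} (a : Fin n) → [ a ≡ᵇ a ] ≡ 1
≡ᵇ-refl a with a ≟ a
... | yes _ = refl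
... | no a≢a = ⊥-elim (a≢a refl)

≡ᵇ-≢ : ∀ {n} {a b : Fin n} → a ≢ b → [ a ≡ᵇ b ] ≡ 0
≡ᵇ-≢ {a = a} {b} a≢b with a ≟ b
... | yes a≡b = ⊥-elim (a≢b a≡b)
... | no _ = refl

module _ {A : Set} (k : ℕ) (f : A → ℕ) where
  allAtLeast : List A → Bool
  allAtLeast = foldr (λ w b → does (k Nat.≤? f w) ∧ b) true

  allAtLeast-sound : ∀ L → allAtLeast L ≡ true → ∀ {w} → w ∈ L → k ≤ₙ f w
  allAtLeast-sound (x ∷ L) passed w∈ with k Nat.≤ᵇ f x in eq
  allAtLeast-sound (x ∷ L) passed (here refl) | true = Natₚ.≤ᵇ⇒≤ k (f x) (subst T (sym eq) tt)
  allAtLeast-sound (x ∷ L) passed (there w∈L) | true = allAtLeast-sound L passed w∈L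

  allAtLeast-complete : ∀ L → (∀ w → k ≤ₙ f w) → allAtLeast L ≡ true
  allAtLeast-complete [] all≥ = refl
  allAtLeast-complete (x ∷ L) all≥ with k Nat.≤ᵇ f x in eq
  ... | true = allAtLeast-complete L all≥
  ... | false = ⊥-elim (subst T eq (Natₚ.≤⇒≤ᵇ (all≥ x)))

module _ {A : Set} (f : A → ℕ) where
  foldMin : ℕ → List A → ℕ
  foldMin x = foldr (λ w m → f w ⊓ m) x

  foldMin-≤ : ∀ x L {w} → w ∈ L → foldMin x L ≤ₙ f w
  foldMin-≤ x (y ∷ L) (here refl) = Natₚ.m⊓n≤m (f y) _
  foldMin-≤ x (y ∷ L) (there w∈L) = Natₚ.≤-trans (Natₚ.m⊓n≤n (f y) _) (foldMin-≤ x L w∈L)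

  foldMin-attained : ∀ v L → ∃ λ u → f u ≡ foldMin (f v) L
  foldMin-attained v [] = v , refl
  foldMin-attained v (y ∷ L) with foldMin-attained v L | Natₚ.⊓-sel (f y) (foldMin (f v) L)
  ... | u , fu≡min | inj₁ min≡fy = y , sym min≡fy
  ... | u , fu≡min | inj₂ min≡rest = u , trans fu≡min (sym min≡rest)

if-won-≤ : ∀ (b₁ b₂ : Bool) {y₁ y₂ : ℚ} → (b₂ ≡ true → b₁ ≡ true) → y₂ ≤ 1ℚ →
           (b₁ ≡ false → y₂ ≤ y₁) → (if b₂ then 1ℚ else y₂) ≤ (if b₁ then 1ℚ else y₁)
if-won-≤ true true _ _ _ = ≤-refl
if-won-≤ true false _ y₂≤1 _ = y₂≤1
if-won-≤ false true won₂⇒won₁ _ _ with won₂⇒won₁ refl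
... | ()
if-won-≤ false false _ _ y₂≤y₁ = y₂≤y₁ refl

if-won-≤1 : ∀ (b : Bool) {y : ℚ} → y ≤ 1ℚ → (if b then 1ℚ else y) ≤ 1ℚ
if-won-≤1 true y≤1 = ≤-refl
if-won-≤1 false y≤1 = y≤1

if-else-mono : ∀ (b : Bool) {x y y' : ℚ} → y ≤ y' → (if b then x else y) ≤ (if b then x else y')
if-else-mono true y≤y' = ≤-refl
if-else-mono false y≤y' = y≤y'

module Game (n k : ℕ) where
  open Capped k

  DegreeVector : Set
  DegreeVector = Fin n → ℕ

  bump : DegreeVector → Fin n → DegreeVector
  bump X u w = X w Nat.+ [ u ≡ᵇ w ]

  bump-same : ∀ X u → bump X u u ≡ Nat.suc (X u)
  bump-same X u rewrite ≡ᵇ-refl u = Natₚ.+-comm (X u) 1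

  bump-other : ∀ X {u w} → u ≢ w → bump X u w ≡ X w
  bump-other X {u} {w} u≢w rewrite ≡ᵇ-≢ u≢w = Natₚ.+-identityʳ (X w)

  deg-∷ : ∀ (h : History n) v u w → deg ((v , u) ∷ h) w ≡ bump (degPlus h v) u w
  deg-∷ h v u w = trans (Natₚ.+-comm ([ v ≡ᵇ w ] Nat.+ [ u ≡ᵇ w ]) (deg h w))
                        (sym (Natₚ.+-assoc (deg h w) [ v ≡ᵇ w ] [ u ≡ᵇ w ]))

  record Coupled (X Y : DegreeVector) (p q : Fin n) : Set where
    field
      distinct  : p ≢ q
      agree     : ∀ w → w ≢ p → w ≢ q → X w ≡ Y w
      dominates : Dominates (X p) (X q) (Y p) (Y q)
  open Coupled

  coupled-sym : ∀ {X Y p q} → Coupled X Y p q → Coupled X Y q p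
  coupled-sym c = record
    { distinct = distinct c ∘ sym
    ; agree = λ w w≢q w≢p → agree c w w≢p w≢q
    ; dominates = swapʳ (swapˡ (dominates c)) }

  coupled-cong : ∀ {X Y X' Y' p q} → Coupled X Y p q → (∀ w → X w ≡ X' w) → (∀ w → Y w ≡ Y' w) →
                 Coupled X' Y' p q
  coupled-cong {p = p} {q} c X≗X' Y≗Y' = record
    { distinct = distinct c
    ; agree = λ w w≢p w≢q → trans (sym (X≗X' w)) (trans (agree c w w≢p w≢q) (Y≗Y' w))
    ; dominates = dominates-cong (sym (X≗X' p)) (sym (X≗X' q)) (sym (Y≗Y' p)) (sym (Y≗Y' q))
                                 (dominates c) }

  coupled-bump-outside : ∀ {X Y p q v} → Coupled X Y p q → v ≢ p → v ≢ q →
                         Coupled (bump X v) (bump Y v) p q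
  coupled-bump-outside {X} {Y} {v = v} c v≢p v≢q = record
    { distinct = distinct c
    ; agree = λ w w≢p w≢q → cong (Nat._+ [ v ≡ᵇ w ]) (agree c w w≢p w≢q)
    ; dominates = dominates-cong (bump-other X v≢p) (bump-other X v≢q) (bump-other Y v≢p)
                                 (bump-other Y v≢q) (dominates c) }

  data End : Set where
    left right : End

  endpoint : End → Fin n → Fin n → Fin n
  endpoint left p q = p
  endpoint right p q = q

  raise₁ raise₂ : End → ℕ → ℕ → ℕ
  raise₁ left a a' = Nat.suc a
  raise₁ right a a' = a
  raise₂ left a a' = a'
  raise₂ right a a' = Nat.suc a'

  bump-pair : ∀ X {p q} → p ≢ q → ∀ e →
              bump X (endpoint e p q) p ≡ raise₁ e (X p) (X q) × bump X (endpoint e p q) q ≡ raise₂ e (X p) (X q)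
  bump-pair X p≢q left = bump-same X _ , bump-other X p≢q
  bump-pair X p≢q right = bump-other X (p≢q ∘ sym) , bump-same X _

  coupled-raise : ∀ {X Y p q} → Coupled X Y p q → (ex ey : End) →
                  Dominates (raise₁ ex (X p) (X q)) (raise₂ ex (X p) (X q)) (raise₁ ey (Y p) (Y q)) (raise₂ ey (Y p) (Y q)) →
                  Coupled (bump X (endpoint ex p q)) (bump Y (endpoint ey p q)) p q
  coupled-raise {X} {Y} {p} {q} c ex ey d = record
    { distinct = distinct c
    ; agree = λ w w≢p w≢q → trans (bump-other X (off ex w≢p w≢q))
                              (trans (agree c w w≢p w≢q) (sym (bump-other Y (off ey w≢p w≢q))))
    ; dominates = dominates-cong (proj₁ (bump-pair X (distinct c) ex)) (proj₂ (bump-pair X (distinct c) ex))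
                                 (proj₁ (bump-pair Y (distinct c) ey)) (proj₂ (bump-pair Y (distinct c) ey)) d }
    where
    off : ∀ e {w} → w ≢ p → w ≢ q → endpoint e p q ≢ w
    off left w≢p w≢q = w≢p ∘ sym
    off right w≢p w≢q = w≢q ∘ sym

  won-transfer : ∀ (h₁ h₂ : History n) {p q} → Coupled (deg h₁) (deg h₂) p q →
                 won k h₂ ≡ true → won k h₁ ≡ true
  won-transfer h₁ h₂ {p} {q} c won₂ = allAtLeast-complete k (deg h₁) (allFin n) done₁
    where
    done₂ : ∀ w → k ≤ₙ deg h₂ w
    done₂ w = allAtLeast-sound k (deg h₂) (allFin n) won₂ (∈-allFin w)
    done₁ : ∀ w → k ≤ₙ deg h₁ w
    done₁ w with w ≟ p
    ... | yes refl = aboveMin-saturated (first (dominates c)) (done₂ p) (done₂ q)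
    ... | no w≢p with w ≟ q
    ... | yes refl = aboveMin-saturated (second (dominates c)) (done₂ p) (done₂ q)
    ... | no w≢q = subst (k ≤ₙ_) (sym (agree c w w≢p w≢q)) (done₂ w)

  respond-at-pair : ∀ {X Y p q} → Coupled X Y p q → Y p ≤ₙ Y q → ∃ λ x → Coupled (bump X x) (bump Y p) p q
  respond-at-pair {X} {Y} {p} {q} c Yp≤Yq with X p Nat.≤? X q
  ... | yes Xp≤Xq = p , coupled-raise c left left (dominates-raise-smaller (dominates c) Xp≤Xq Yp≤Yq)
  ... | no Xp≰Xq = q , coupled-raise c right left
                         (swapˡ (dominates-raise-smaller (swapˡ (dominates c)) (Natₚ.≰⇒≥ Xp≰Xq) Yp≤Yq))

  respond : ∀ {X Y p q b} → Coupled X Y p q → (∀ w → Y b ≤ₙ Y w) → ∃ λ x → Coupled (bump X x) (bump Y b) p q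
  respond {p = p} {q} {b} c b-min with b ≟ p
  ... | yes refl = respond-at-pair c (b-min q)
  ... | no b≢p with b ≟ q
  ... | yes refl = let (x , c') = respond-at-pair (coupled-sym c) (b-min p) in x , coupled-sym c'
  ... | no b≢q = b , coupled-bump-outside c b≢p b≢q

  IsMinimum : History n → Fin n → Fin n → Set
  IsMinimum h v u = ∀ w → degPlus h v u ≤ₙ degPlus h v w

  attains-minimum : ∀ h v u → degPlus h v u ≡ minDeg h v → IsMinimum h v u
  attains-minimum h v u u-min w =
    subst (_≤ₙ degPlus h v w) (sym u-min) (foldMin-≤ (degPlus h v) _ (allFin n) (∈-allFin w))

  isMin-cases : ∀ h v u → isMin h v u ≡ 0 ⊎ IsMinimum h v u
  isMin-cases h v u with degPlus h v u Nat.≡ᵇ minDeg h v in eq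
  ... | false = inj₁ refl
  ... | true = inj₂ (attains-minimum h v u (Natₚ.≡ᵇ⇒≡ _ _ (subst T (sym eq) tt)))

  minimum-exists : ∀ h v → ∃ λ u → isMin h v u ≡ 1 × IsMinimum h v u
  minimum-exists h v with foldMin-attained (degPlus h v) v (allFin n)
  ... | u , u-min = u , isMin≡1 , attains-minimum h v u u-min
    where
    isMin≡1 : isMin h v u ≡ 1
    isMin≡1 with degPlus h v u Nat.≡ᵇ minDeg h v in eq
    ... | true = refl
    ... | false = ⊥-elim (subst T eq (Natₚ.≡⇒≡ᵇ _ _ u-min))

  S†min-distribution : ∀ h v → IsDistribution (allFin n) (S†min h v)
  S†min-distribution h v = nonNeg , total
    where
    nonNeg : ∀ u → 0ℚ ≤ S†min h v u
    nonNeg u = *-nonNeg (ofℕ-nonNeg (isMin h v u)) (inv-nonNeg (countMin h v))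
    count≥1 : 1 ≤ₙ countMin h v
    count≥1 with minimum-exists h v
    ... | u , isMin≡1 , _ = subst (_≤ₙ countMin h v) isMin≡1 (sumℕ-≥ (isMin h v) (allFin n) (∈-allFin u))
    total : ΣQ n (S†min h v) ≡ 1ℚ
    total = begin
      ΣQ n (S†min h v)                                   ≡⟨ sumL-*ʳ (allFin n) (ofℕ ∘ isMin h v) (inv (countMin h v)) ⟩
      sumL (allFin n) (ofℕ ∘ isMin h v) * inv (countMin h v) ≡⟨ cong (_* inv (countMin h v)) (sumL-ofℕ (allFin n) (isMin h v)) ⟩
      ofℕ (countMin h v) * inv (countMin h v)            ≡⟨ uniform-mass (countMin h v) count≥1 ⟩
      1ℚ                                                 ∎
      where
      open ≡-Reasoning
      uniform-mass : ∀ c → 1 ≤ₙ c → ofℕ c * inv c ≡ 1ℚ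
      uniform-mass (Nat.suc m) _ = ofℕ*inv m

  S†min-support : ∀ h v u → S†min h v u ≡ 0ℚ ⊎ IsMinimum h v u
  S†min-support h v u with isMin-cases h v u
  ... | inj₁ isMin≡0 = inj₁ (trans (cong (λ m → ofℕ m * inv (countMin h v)) isMin≡0) (*-zeroˡ (inv (countMin h v))))
  ... | inj₂ u-min = inj₂ u-min

  value : History n → ℕ → ℚ
  value h t = winProbFrom k S†min h t

  afterOffer : History n → Fin n → ℕ → ℚ
  afterOffer h v t = ΣQ n (λ u → S†min h v u * value ((v , u) ∷ h) t)

  -- the average over the uniform offer; value h (suc t) is this unless h is won
  roundAverage : History n → ℕ → ℚ
  roundAverage h t = ΣQ n (λ v → inv n * afterOffer h v t)

  value≤1 : ∀ t h → value h t ≤ 1ℚ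
  roundAverage≤1 : ∀ t h → roundAverage h t ≤ 1ℚ

  value≤1 Nat.zero h = if-won-≤1 (won k h) (nonNegative⁻¹ 1ℚ)
  value≤1 (Nat.suc t) h = if-won-≤1 (won k h) (roundAverage≤1 t h)

  roundAverage≤1 t h = begin
    roundAverage h t          ≤⟨ sumL-mono (allFin n) (λ v → *-monoˡ-nonNeg (inv-nonNeg n) (afterOffer≤1 v)) ⟩
    ΣQ n (λ v → inv n * 1ℚ)   ≡⟨ sumL-cong (allFin n) (λ _ → *-identityʳ (inv n)) ⟩
    ΣQ n (λ v → inv n)        ≡⟨ sumL-const (allFin n) (inv n) ⟩
    ofℕ (length (allFin n)) * inv n ≡⟨ cong (λ m → ofℕ m * inv n) (length-tabulate {n = n} id) ⟩
    ofℕ n * inv n             ≤⟨ ofℕ*inv≤1 n ⟩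
    1ℚ                        ∎
    where
    open Data.Rational.Properties.≤-Reasoning
    afterOffer≤1 : ∀ v → afterOffer h v t ≤ 1ℚ
    afterOffer≤1 v = average-≤ (allFin n) 1ℚ (S†min-distribution h v) (λ u → inj₂ (value≤1 t _))

  Monotone : ℕ → Set
  Monotone t = ∀ h₁ h₂ {p q} → Coupled (deg h₁) (deg h₂) p q → value h₂ t ≤ value h₁ t

  module OneRound (t : ℕ) (mono : Monotone t) where
    -- (i) Answering v with a minimum-degree vertex u' is at least as good as any answer u:
    -- the two outcomes differ only on {u' , u}, where the pair is more balanced.
    minimum-answer-best : ∀ h v u {u'} → IsMinimum h v u' → value ((v , u) ∷ h) t ≤ value ((v , u') ∷ h) t
    minimum-answer-best h v u {u'} u'-min = compare (u' ≟ u)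
      where
      compare : Dec (u' ≡ u) → value ((v , u) ∷ h) t ≤ value ((v , u') ∷ h) t
      compare (yes u'≡u) = ≤-reflexive (cong (λ x → value ((v , x) ∷ h) t) (sym u'≡u))
      compare (no u'≢u) = mono ((v , u') ∷ h) ((v , u) ∷ h)
                        (coupled-cong raised (λ w → sym (deg-∷ h v u' w)) (λ w → sym (deg-∷ h v u w)))
        where
        E : DegreeVector
        E = degPlus h v
        same : Coupled E E u' u
        same = record { distinct = u'≢u ; agree = λ _ _ _ → refl
                      ; dominates = dom (inj₁ Natₚ.≤-refl) (inj₂ Natₚ.≤-refl) Natₚ.≤-refl }
        raised : Coupled (bump E u') (bump E u) u' u
        raised = coupled-raise same left right (dominates-lower-end (u'-min u))

    answer≤afterOffer : ∀ h v u → value ((v , u) ∷ h) t ≤ afterOffer h v t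
    answer≤afterOffer h v u = average-≥ (allFin n) (value ((v , u) ∷ h) t) (S†min-distribution h v)
                                (λ u' → Sum.map₂ (minimum-answer-best h v u) (S†min-support h v u'))

    afterOffer≤minimum-answer : ∀ h v {b} → IsMinimum h v b → afterOffer h v t ≤ value ((v , b) ∷ h) t
    afterOffer≤minimum-answer h v {b} b-min = average-≤ (allFin n) (value ((v , b) ∷ h) t) (S†min-distribution h v)
                                                (λ u → inj₂ (minimum-answer-best h v u b-min))

    afterOffer-coupled : ∀ h₁ v₁ h₂ v₂ {p q} → Coupled (degPlus h₁ v₁) (degPlus h₂ v₂) p q →
                         afterOffer h₂ v₂ t ≤ afterOffer h₁ v₁ t
    afterOffer-coupled h₁ v₁ h₂ v₂ c = begin
      afterOffer h₂ v₂ t          ≤⟨ afterOffer≤minimum-answer h₂ v₂ b-min ⟩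
      value ((v₂ , b) ∷ h₂) t     ≤⟨ mono ((v₁ , x) ∷ h₁) ((v₂ , b) ∷ h₂)
                                       (coupled-cong c' (λ w → sym (deg-∷ h₁ v₁ x w)) (λ w → sym (deg-∷ h₂ v₂ b w))) ⟩
      value ((v₁ , x) ∷ h₁) t     ≤⟨ answer≤afterOffer h₁ v₁ x ⟩
      afterOffer h₁ v₁ t          ∎
      where
      open Data.Rational.Properties.≤-Reasoning
      b : Fin n
      b = proj₁ (minimum-exists h₂ v₂)
      b-min : IsMinimum h₂ v₂ b
      b-min = proj₂ (proj₂ (minimum-exists h₂ v₂))
      x : Fin n
      x = proj₁ (respond c b-min)
      c' : Coupled (bump (degPlus h₁ v₁) x) (bump (degPlus h₂ v₂) b) _ _
      c' = proj₂ (respond c b-min)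

    afterOffer-pair-ordered : ∀ h₁ h₂ {p q} → Coupled (deg h₁) (deg h₂) p q → deg h₂ p ≤ₙ deg h₂ q →
                              afterOffer h₂ p t + afterOffer h₂ q t ≤ afterOffer h₁ p t + afterOffer h₁ q t
    afterOffer-pair-ordered h₁ h₂ {p} {q} c Yp≤Yq = byBetterOrder (deg h₁ p Nat.≤? deg h₁ q)
      where
      d : Dominates (deg h₁ p) (deg h₁ q) (deg h₂ p) (deg h₂ q)
      d = dominates c
      byBetterOrder : Dec (deg h₁ p ≤ₙ deg h₁ q) →
                      afterOffer h₂ p t + afterOffer h₂ q t ≤ afterOffer h₁ p t + afterOffer h₁ q t
      byBetterOrder (yes Xp≤Xq) = +-mono-≤
          (afterOffer-coupled h₁ p h₂ p (coupled-raise c left left (dominates-raise-smaller d Xp≤Xq Yp≤Yq)))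
          (afterOffer-coupled h₁ q h₂ q (coupled-raise c right right (dominates-raise-larger d Xp≤Xq Yp≤Yq)))
      -- the better side's smaller end is q, so the offers are paired crosswise
      byBetterOrder (no Xp≰Xq) = ≤-trans (+-mono-≤
          (afterOffer-coupled h₁ q h₂ p (coupled-raise c right left
            (swapˡ (dominates-raise-smaller (swapˡ d) (Natₚ.≰⇒≥ Xp≰Xq) Yp≤Yq))))
          (afterOffer-coupled h₁ p h₂ q (coupled-raise c left right
            (swapˡ (dominates-raise-larger (swapˡ d) (Natₚ.≰⇒≥ Xp≰Xq) Yp≤Yq)))))
          (≤-reflexive (+-comm (afterOffer h₁ q t) (afterOffer h₁ p t)))

    afterOffer-pair : ∀ h₁ h₂ {p q} → Coupled (deg h₁) (deg h₂) p q →
                      afterOffer h₂ p t + afterOffer h₂ q t ≤ afterOffer h₁ p t + afterOffer h₁ q t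
    afterOffer-pair h₁ h₂ {p} {q} c = byWorseOrder (deg h₂ p Nat.≤? deg h₂ q)
      where
      open Data.Rational.Properties.≤-Reasoning
      byWorseOrder : Dec (deg h₂ p ≤ₙ deg h₂ q) →
                     afterOffer h₂ p t + afterOffer h₂ q t ≤ afterOffer h₁ p t + afterOffer h₁ q t
      byWorseOrder (yes Yp≤Yq) = afterOffer-pair-ordered h₁ h₂ c Yp≤Yq
      byWorseOrder (no Yp≰Yq) = begin
        afterOffer h₂ p t + afterOffer h₂ q t  ≡⟨ +-comm (afterOffer h₂ p t) (afterOffer h₂ q t) ⟩
        afterOffer h₂ q t + afterOffer h₂ p t  ≤⟨ afterOffer-pair-ordered h₁ h₂ (coupled-sym c) (Natₚ.≰⇒≥ Yp≰Yq) ⟩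
        afterOffer h₁ q t + afterOffer h₁ p t  ≡⟨ +-comm (afterOffer h₁ q t) (afterOffer h₁ p t) ⟩
        afterOffer h₁ p t + afterOffer h₁ q t  ∎

    -- Averaging over the uniform offer: offers outside {p , q} keep the coupling,
    -- and the offers p , q are handled jointly by (iii).
    roundAverage-coupled : ∀ h₁ h₂ {p q} → Coupled (deg h₁) (deg h₂) p q → roundAverage h₂ t ≤ roundAverage h₁ t
    roundAverage-coupled h₁ h₂ {p} {q} c = begin
      roundAverage h₂ t   ≡⟨ ΣQ≡sumFin n (weighted h₂) ⟩
      sumFin n (weighted h₂) ≤⟨ sumFin-pair-mono n (weighted h₁) (weighted h₂) (distinct c) outside onPair ⟩
      sumFin n (weighted h₁) ≡⟨ ΣQ≡sumFin n (weighted h₁) ⟨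
      roundAverage h₁ t   ∎
      where
      open Data.Rational.Properties.≤-Reasoning
      weighted : History n → Fin n → ℚ
      weighted h v = inv n * afterOffer h v t
      outside : ∀ v → v ≢ p → v ≢ q → weighted h₂ v ≤ weighted h₁ v
      outside v v≢p v≢q = *-monoˡ-nonNeg (inv-nonNeg n) (afterOffer-coupled h₁ v h₂ v (coupled-bump-outside c v≢p v≢q))
      onPair : weighted h₂ p + weighted h₂ q ≤ weighted h₁ p + weighted h₁ q
      onPair = begin
        weighted h₂ p + weighted h₂ q                  ≡⟨ *-distribˡ-+ (inv n) (afterOffer h₂ p t) (afterOffer h₂ q t) ⟨
        inv n * (afterOffer h₂ p t + afterOffer h₂ q t) ≤⟨ *-monoˡ-nonNeg (inv-nonNeg n) (afterOffer-pair h₁ h₂ c) ⟩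
        inv n * (afterOffer h₁ p t + afterOffer h₁ q t) ≡⟨ *-distribˡ-+ (inv n) (afterOffer h₁ p t) (afterOffer h₁ q t) ⟩
        weighted h₁ p + weighted h₁ q                  ∎

  monotone : ∀ t → Monotone t
  monotone Nat.zero h₁ h₂ c =
    if-won-≤ (won k h₁) (won k h₂) (won-transfer h₁ h₂ c) (nonNegative⁻¹ 1ℚ) (λ _ → ≤-refl)
  monotone (Nat.suc t) h₁ h₂ c =
    if-won-≤ (won k h₁) (won k h₂) (won-transfer h₁ h₂ c) (roundAverage≤1 t h₂)
             (λ _ → OneRound.roundAverage-coupled t (monotone t) h₁ h₂ c)

  optimal : (σ : Strategy n) → IsStrategy σ → ∀ t h → winProbFrom k σ h t ≤ value h t
  optimal σ σ-valid Nat.zero h = ≤-refl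
  optimal σ σ-valid (Nat.suc t) h =
    if-else-mono (won k h) (sumL-mono (allFin n) (λ v → *-monoˡ-nonNeg (inv-nonNeg n) (σ-answer≤ v)))
    where
    open OneRound t (monotone t)
    σ-answer≤ : ∀ v → ΣQ n (λ u → σ h v u * winProbFrom k σ ((v , u) ∷ h) t) ≤ afterOffer h v t
    σ-answer≤ v = ≤-trans
      (weighted-mono (allFin n) (σ h v) (proj₁ (σ-valid h v)) (λ u → inj₂ (optimal σ σ-valid t ((v , u) ∷ h))))
      (average-≤ (allFin n) (afterOffer h v t) (σ-valid h v) (λ u → inj₂ (answer≤afterOffer h v u)))

lemma5p2 : (n k : ℕ) → (σ : Strategy n) → IsStrategy σ → (t : ℕ) →
    winProb k σ t ≤ winProb k (S†min {n}) t
lemma5p2 n k σ σ-valid t = Game.optimal n k σ σ-valid t []
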